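{- For propositional variables $p,q$: ${\bf ITL}^{\bf FS}\not\vdash \Box(p\vee q)\to\Box p\vee\Diamond q$ and ${\bf ITL}^{\bf FS}\not\vdash \Box(p\vee q)\wedge\Box(\circ q\to q)\to\Box p\vee q$.
   Context: Fix a countably infinite set $\mathbb P$ of propositional variables. The language $\mathcal L$ is given by $\varphi ::= \bot \mid p \mid \varphi\wedge\varphi \mid \varphi\vee\varphi\mid \varphi\to\varphi\mid \circ\varphi\mid\Diamond\varphi\mid\Box\varphi$ with $p\in\mathbb P$; $\neg\varphi$ abbreviates $\varphi\to\bot$, $\varphi\leftrightarrow\psi$ abbreviates $(\varphi\to\psi)\wedge(\psi\to\varphi)$. ${\bf ITL}^{\bf FS}$ is the least set of $\mathcal L$-formulas containing all ($\mathcal L$-instances of) intuitionistic propositional tautologies and all instances of $\neg\circ\bot$; $\circ(\varphi\wedge\psi)\leftrightarrow(\circ\varphi\wedge\circ\psi)$; $\circ(\varphi\vee\psi)\leftrightarrow(\circ\varphi\vee\circ\psi)$; $\circ(\varphi\to\psi)\to(\circ\varphi\to\circ\psi)$; $\Box(\varphi\to\psi)\to(\Box\varphi\to\Box\psi)$; $\Box(\varphi\to\psi)\to(\Diamond\varphi\to\Diamond\psi)$; $\Diamond(\varphi\vee\psi)\to(\Diamond\varphi\vee\Diamond\psi)$; $\Box\varphi\to\varphi\wedge\circ\Box\varphi$; $\varphi\vee\circ\Diamond\varphi\to\Diamond\varphi$; $(\circ\varphi\to\circ\psi)\to\circ(\varphi\to\psi)$; $(\Diamond\varphi\to\Box\psi)\to\Box(\varphi\to\psi)$;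 and closed under: from $\varphi\to\circ\varphi$ infer $\varphi\to\Box\varphi$; from $\circ\varphi\to\varphi$ infer $\Diamond\varphi\to\varphi$; modus ponens; from $\varphi$ infer $\circ\varphi$. ${\bf ITL}^{\bf FS}\vdash\varphi$ means $\varphi\in{\bf ITL}^{\bf FS}$. -}

module Defs where

open import Data.Nat using (ℕ)

data Form : Set where
  ⊥'   : Form
  var  : ℕ → Form
  _∧'_ : Form → Form → Form
  _∨'_ : Form → Form → Form
  _⇒_  : Form → Form → Form
  ○    : Form → Form
  ◇    : Form → Form
  □    : Form → Form

infixr 6 _∧'_
infixr 5 _∨'_
infixr 4 _⇒_

¬' : Form → Form
¬' φ = φ ⇒ ⊥'

_⇔_ : Form → Form → Form
φ ⇔ ψ = (φ ⇒ ψ) ∧' (ψ ⇒ φ)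

data PForm : Set where
  ⊥ₚ   : PForm
  varₚ : ℕ → PForm
  _∧ₚ_ : PForm → PForm → PForm
  _∨ₚ_ : PForm → PForm → PForm
  _⇒ₚ_ : PForm → PForm → PForm

-- Intuitionistic propositional tautologies: theorems of a standard
-- Hilbert calculus for intuitionistic propositional logic (IPC).
data IPC : PForm → Set where
  ax-K    : ∀ A B → IPC (A ⇒ₚ (B ⇒ₚ A))
  ax-S    : ∀ A B C → IPC ((A ⇒ₚ (B ⇒ₚ C)) ⇒ₚ ((A ⇒ₚ B) ⇒ₚ (A ⇒ₚ C)))
  ax-∧I   : ∀ A B → IPC (A ⇒ₚ (B ⇒ₚ (A ∧ₚ B)))
  ax-∧E₁  : ∀ A B → IPC ((A ∧ₚ B) ⇒ₚ A)
  ax-∧E₂  : ∀ A B → IPC ((A ∧ₚ B) ⇒ₚ B)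
  ax-∨I₁  : ∀ A B → IPC (A ⇒ₚ (A ∨ₚ B))
  ax-∨I₂  : ∀ A B → IPC (B ⇒ₚ (A ∨ₚ B))
  ax-∨E   : ∀ A B C → IPC ((A ⇒ₚ C) ⇒ₚ ((B ⇒ₚ C) ⇒ₚ ((A ∨ₚ B) ⇒ₚ C)))
  ax-⊥E   : ∀ A → IPC (⊥ₚ ⇒ₚ A)
  mpₚ     : ∀ {A B} → IPC (A ⇒ₚ B) → IPC A → IPC B

inst : (ℕ → Form) → PForm → Form
inst σ ⊥ₚ        = ⊥'
inst σ (varₚ n)  = σ n
inst σ (A ∧ₚ B)  = inst σ A ∧' inst σ B
inst σ (A ∨ₚ B)  = inst σ A ∨' inst σ B
inst σ (A ⇒ₚ B)  = inst σ A ⇒ inst σ B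

data ITLFS : Form → Set where
  taut     : ∀ (σ : ℕ → Form) A → IPC A → ITLFS (inst σ A)
  ax1      : ITLFS (¬' (○ ⊥'))
  ax2      : ∀ φ ψ → ITLFS (○ (φ ∧' ψ) ⇔ (○ φ ∧' ○ ψ))
  ax3      : ∀ φ ψ → ITLFS (○ (φ ∨' ψ) ⇔ (○ φ ∨' ○ ψ))
  ax4      : ∀ φ ψ → ITLFS (○ (φ ⇒ ψ) ⇒ (○ φ ⇒ ○ ψ))
  ax5      : ∀ φ ψ → ITLFS (□ (φ ⇒ ψ) ⇒ (□ φ ⇒ □ ψ))
  ax6      : ∀ φ ψ → ITLFS (□ (φ ⇒ ψ) ⇒ (◇ φ ⇒ ◇ ψ))
  ax7      : ∀ φ ψ → ITLFS (◇ (φ ∨' ψ) ⇒ (◇ φ ∨' ◇ ψ))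
  ax8      : ∀ φ → ITLFS (□ φ ⇒ (φ ∧' ○ (□ φ)))
  ax9      : ∀ φ → ITLFS ((φ ∨' ○ (◇ φ)) ⇒ ◇ φ)
  ax10     : ∀ φ ψ → ITLFS ((○ φ ⇒ ○ ψ) ⇒ ○ (φ ⇒ ψ))
  ax11     : ∀ φ ψ → ITLFS ((◇ φ ⇒ □ ψ) ⇒ □ (φ ⇒ ψ))
  ind□     : ∀ {φ} → ITLFS (φ ⇒ ○ φ) → ITLFS (φ ⇒ □ φ)
  ind◇     : ∀ {φ} → ITLFS (○ φ ⇒ φ) → ITLFS (◇ φ ⇒ φ)
  mp       : ∀ {φ ψ} → ITLFS (φ ⇒ ψ) → ITLFS φ → ITLFS ψ
  nec○     : ∀ {φ} → ITLFS φ → ITLFS (○ φ)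

module Submission where

-- Both formulas are refuted by soundness with respect to a dynamic
-- topological model.  The space is the one-point compactification
-- ℕ∞ = ℕ ∪ {∞} of the discrete naturals; its open sets are the sets which,
-- if they contain ∞, contain a cofinite set of naturals.  Formulas denote
-- time-indexed families of such opens: the connectives are the Heyting
-- operations on opens, ○ shifts time by one, □ is the interior of the
-- intersection over all later times and ◇ is the union over later times.
--
-- Finally
-- a countermodel interprets p by the opens P t = {m | t < m} ∪ {∞} and q by
-- the constant open ℕ: at ∞ the hypotheses hold, while □p fails at ∞
-- (no cofinite set of points satisfies p forever) and q, ◇q fail at ∞.

open import Defs
open import Data.Nat using (ℕ; zero; suc; _+_; _≤_; _<_; _⊔_; _≟_)
open import Data.Nat.Properties using (≤-trans; ≤-refl; m≤m⊔n; m≤n⊔m; +-suc; m+n≮m)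
open import Relation.Nullary using (¬_; yes; no)
open import Relation.Binary.PropositionalEquality
  using (_≢_; _≡_; refl; sym; subst; cong; cong₂)
open import Data.Product using (_×_; Σ; _,_; proj₁; proj₂)
open import Data.Sum using (_⊎_; inj₁; inj₂; [_,_])
open import Data.Empty using (⊥; ⊥-elim)
open import Data.Unit using (⊤; tt)

-- "Eventually P": P holds on a cofinite set of naturals, i.e. on a
-- neighbourhood of ∞ in ℕ∞.
-- Without eta-equality, so that neighbourhood witnesses are not split into
-- components during unification and opens remain inferable from inclusions.
record Eventually (P : ℕ → Set) : Set where
  no-eta-equality
  pattern
  constructor from_onwards
  field
    start : ℕ
    holds : ∀ m → start ≤ m → P m

Eventually-map : ∀ {P Q : ℕ → Set} → (∀ m → P m → Q m) → Eventually P → Eventually Q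
Eventually-map f (from N onwards g) = from N onwards λ m N≤m → f m (g m N≤m)

Eventually-zip : ∀ {P Q R : ℕ → Set} → (∀ m → P m → Q m → R m) →
                 Eventually P → Eventually Q → Eventually R
Eventually-zip f (from N onwards g) (from M onwards h) =
  from N ⊔ M onwards λ m N⊔M≤m →
    f m (g m (≤-trans (m≤m⊔n N M) N⊔M≤m)) (h m (≤-trans (m≤n⊔m N M) N⊔M≤m))

-- A (proof-relevant) open subset of ℕ∞: membership of each natural, of ∞,
-- and the openness condition that membership of ∞ yields a neighbourhood.
record Open : Set₁ where
  field
    fin  : ℕ → Set
    inf  : Set
    nbhd : inf → Eventually fin
open Open

infix 2 _⊆_
record _⊆_ (a b : Open) : Set where
  constructor incl
  field
    at-fin : ∀ m → fin a m → fin b m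
    at-inf : inf a → inf b
open _⊆_

⊆-refl : ∀ {a} → a ⊆ a
⊆-refl = incl (λ m x → x) (λ x → x)

⊆-reflexive : ∀ {a b} → a ≡ b → a ⊆ b
⊆-reflexive refl = ⊆-refl

infixr 9 _⨾_
_⨾_ : ∀ {a b c} → a ⊆ b → b ⊆ c → a ⊆ c
f ⨾ g = incl (λ m x → at-fin g m (at-fin f m x)) (λ x → at-inf g (at-inf f x))

-- The Heyting operations.  Meet and join are pointwise; implication is the
-- interior of the pointwise implication, which at ∞ additionally asks the
-- implication to hold on a neighbourhood of ∞.
⊥ᵛ : Open
⊥ᵛ = record { fin = λ _ → ⊥ ; inf = ⊥ ; nbhd = λ () }

infixr 6 _∧ᵛ_
_∧ᵛ_ : Open → Open → Open
a ∧ᵛ b = record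
  { fin  = λ m → fin a m × fin b m
  ; inf  = inf a × inf b
  ; nbhd = λ (x , y) → Eventually-zip (λ _ → _,_) (nbhd a x) (nbhd b y) }

infixr 5 _∨ᵛ_
_∨ᵛ_ : Open → Open → Open
a ∨ᵛ b = record
  { fin  = λ m → fin a m ⊎ fin b m
  ; inf  = inf a ⊎ inf b
  ; nbhd = [ (λ x → Eventually-map (λ _ → inj₁) (nbhd a x))
           , (λ y → Eventually-map (λ _ → inj₂) (nbhd b y)) ] }

infixr 4 _⇒ᵛ_
_⇒ᵛ_ : Open → Open → Open
a ⇒ᵛ b = record
  { fin  = λ m → fin a m → fin b m
  ; inf  = (inf a → inf b) × Eventually (λ m → fin a m → fin b m)
  ; nbhd = proj₂ }

⊥-least : ∀ {a} → ⊥ᵛ ⊆ a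
⊥-least = incl (λ m ()) (λ ())

π₁ : ∀ {a b} → a ∧ᵛ b ⊆ a
π₁ = incl (λ m → proj₁) proj₁

π₂ : ∀ {a b} → a ∧ᵛ b ⊆ b
π₂ = incl (λ m → proj₂) proj₂

⟨_,_⟩ : ∀ {a b c} → c ⊆ a → c ⊆ b → c ⊆ a ∧ᵛ b
⟨ f , g ⟩ = incl (λ m x → at-fin f m x , at-fin g m x) (λ x → at-inf f x , at-inf g x)

ι₁ : ∀ {a b} → a ⊆ a ∨ᵛ b
ι₁ = incl (λ m → inj₁) inj₁

ι₂ : ∀ {a b} → b ⊆ a ∨ᵛ b
ι₂ = incl (λ m → inj₂) inj₂

[_,_]ᵛ : ∀ {a b c} → a ⊆ c → b ⊆ c → a ∨ᵛ b ⊆ c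
[ f , g ]ᵛ = incl (λ m → [ at-fin f m , at-fin g m ]) [ at-inf f , at-inf g ]

-- Openness of a supplies the
-- neighbourhood of ∞ required by the implication.  The opens b and c are
-- explicit because b ⇒ᵛ c does not record their openness witnesses.
curry : ∀ {a} b c → a ∧ᵛ b ⊆ c → a ⊆ b ⇒ᵛ c
curry {a} b c f = incl (λ m x y → at-fin f m (x , y)) λ x →
  (λ y → at-inf f (x , y)) , Eventually-map (λ m x′ y → at-fin f m (x′ , y)) (nbhd a x)

record Valid (a : Open) : Set where
  constructor valid
  field
    everywhere : ∀ m → fin a m
    at-∞       : inf a
open Valid

⊆⇒valid : ∀ a b → a ⊆ b → Valid (a ⇒ᵛ b)
⊆⇒valid a b f = valid (at-fin f) (at-inf f , from 0 onwards λ m _ → at-fin f m)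

valid⇒⊆ : ∀ {a b} → Valid (a ⇒ᵛ b) → a ⊆ b
valid⇒⊆ (valid f (g , _)) = incl f g

valid-∧ : ∀ {a b} → Valid a → Valid b → Valid (a ∧ᵛ b)
valid-∧ (valid f x) (valid g y) = valid (λ m → f m , g m) (x , y)

valid-mp : ∀ {a b} → Valid (a ⇒ᵛ b) → Valid a → Valid b
valid-mp (valid f (g , _)) (valid x y) = valid (λ m → f m (x m)) (g y)

⟦_⟧ₚ : PForm → (ℕ → Open) → Open
⟦ ⊥ₚ ⟧ₚ ρ     = ⊥ᵛ
⟦ varₚ n ⟧ₚ ρ = ρ n
⟦ A ∧ₚ B ⟧ₚ ρ = ⟦ A ⟧ₚ ρ ∧ᵛ ⟦ B ⟧ₚ ρ
⟦ A ∨ₚ B ⟧ₚ ρ = ⟦ A ⟧ₚ ρ ∨ᵛ ⟦ B ⟧ₚ ρ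
⟦ A ⇒ₚ B ⟧ₚ ρ = ⟦ A ⟧ₚ ρ ⇒ᵛ ⟦ B ⟧ₚ ρ

entailsₚ : ∀ A B ρ → ⟦ A ⟧ₚ ρ ⊆ ⟦ B ⟧ₚ ρ → Valid (⟦ A ⇒ₚ B ⟧ₚ ρ)
entailsₚ A B ρ = ⊆⇒valid (⟦ A ⟧ₚ ρ) (⟦ B ⟧ₚ ρ)

ipc-sound : ∀ {A} → IPC A → ∀ ρ → Valid (⟦ A ⟧ₚ ρ)
ipc-sound (ax-K A B) ρ = entailsₚ A (B ⇒ₚ A) ρ
  (curry (⟦ B ⟧ₚ ρ) (⟦ A ⟧ₚ ρ) π₁)
ipc-sound (ax-S A B C) ρ = entailsₚ (A ⇒ₚ (B ⇒ₚ C)) ((A ⇒ₚ B) ⇒ₚ (A ⇒ₚ C)) ρ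
  (curry (⟦ A ⇒ₚ B ⟧ₚ ρ) (⟦ A ⇒ₚ C ⟧ₚ ρ) (curry (⟦ A ⟧ₚ ρ) (⟦ C ⟧ₚ ρ)
    (incl (λ m ((h , g) , x) → h x (g x))
          (λ ((h , g) , x) → proj₁ (proj₁ h x) (proj₁ g x)))))
ipc-sound (ax-∧I A B) ρ = entailsₚ A (B ⇒ₚ (A ∧ₚ B)) ρ
  (curry (⟦ B ⟧ₚ ρ) (⟦ A ∧ₚ B ⟧ₚ ρ) ⊆-refl)
ipc-sound (ax-∧E₁ A B) ρ = entailsₚ (A ∧ₚ B) A ρ π₁
ipc-sound (ax-∧E₂ A B) ρ = entailsₚ (A ∧ₚ B) B ρ π₂
ipc-sound (ax-∨I₁ A B) ρ = entailsₚ A (A ∨ₚ B) ρ ι₁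
ipc-sound (ax-∨I₂ A B) ρ = entailsₚ B (A ∨ₚ B) ρ ι₂
ipc-sound (ax-∨E A B C) ρ = entailsₚ (A ⇒ₚ C) ((B ⇒ₚ C) ⇒ₚ ((A ∨ₚ B) ⇒ₚ C)) ρ
  (curry (⟦ B ⇒ₚ C ⟧ₚ ρ) (⟦ (A ∨ₚ B) ⇒ₚ C ⟧ₚ ρ) (curry (⟦ A ∨ₚ B ⟧ₚ ρ) (⟦ C ⟧ₚ ρ)
    (incl (λ m ((f , g) , x) → [ f , g ] x)
          (λ ((f , g) , x) → [ proj₁ f , proj₁ g ] x))))
ipc-sound (ax-⊥E A) ρ = entailsₚ ⊥ₚ A ρ ⊥-least
ipc-sound (mpₚ d e) ρ = valid-mp (ipc-sound d ρ) (ipc-sound e ρ)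

□ᵛ : (ℕ → Open) → ℕ → Open
□ᵛ X t = record
  { fin  = λ m → ∀ k → fin (X (k + t)) m
  ; inf  = (∀ k → inf (X (k + t))) × Eventually (λ m → ∀ k → fin (X (k + t)) m)
  ; nbhd = proj₂ }

◇ᵛ : (ℕ → Open) → ℕ → Open
◇ᵛ X t = record
  { fin  = λ m → Σ ℕ λ k → fin (X (k + t)) m
  ; inf  = Σ ℕ λ k → inf (X (k + t))
  ; nbhd = λ (k , x) → Eventually-map (λ m y → k , y) (nbhd (X (k + t)) x) }

□-elim : ∀ X {t} k → □ᵛ X t ⊆ X (k + t)
□-elim X k = incl (λ m h → h k) (λ (h , _) → h k)

□-intro : ∀ {a} X {t} → (∀ k → a ⊆ X (k + t)) → a ⊆ □ᵛ X t
□-intro {a} X f = incl (λ m x k → at-fin (f k) m x) λ x →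
  (λ k → at-inf (f k) x) , Eventually-map (λ m x′ k → at-fin (f k) m x′) (nbhd a x)

◇-intro : ∀ X {t} k → X (k + t) ⊆ ◇ᵛ X t
◇-intro X k = incl (λ m x → k , x) (λ x → k , x)

◇-elim : ∀ {a} X {t} → (∀ k → X (k + t) ⊆ a) → ◇ᵛ X t ⊆ a
◇-elim X f = incl (λ m (k , x) → at-fin (f k) m x) (λ (k , x) → at-inf (f k) x)

valid-□ : ∀ X t → (∀ s → Valid (X s)) → Valid (□ᵛ X t)
valid-□ X t v = valid (λ m k → everywhere (v (k + t)) m)
  ((λ k → at-∞ (v (k + t))) , from 0 onwards λ m _ k → everywhere (v (k + t)) m)

later : ∀ (X : ℕ → Open) k t → X (k + suc t) ≡ X (suc k + t)
later X k t = cong X (+-suc k t)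

increasing : ∀ (X : ℕ → Open) → (∀ s → X s ⊆ X (suc s)) → ∀ k t → X t ⊆ X (k + t)
increasing X step zero    t = ⊆-refl
increasing X step (suc k) t = increasing X step k t ⨾ step (k + t)

decreasing : ∀ (X : ℕ → Open) → (∀ s → X (suc s) ⊆ X s) → ∀ k t → X (k + t) ⊆ X t
decreasing X step zero    t = ⊆-refl
decreasing X step (suc k) t = step (k + t) ⨾ decreasing X step k t

module Semantics (V : ℕ → ℕ → Open) where

  ⟦_⟧ : Form → ℕ → Open
  ⟦ ⊥' ⟧    t = ⊥ᵛ
  ⟦ var n ⟧ t = V n t
  ⟦ φ ∧' ψ ⟧ t = ⟦ φ ⟧ t ∧ᵛ ⟦ ψ ⟧ t
  ⟦ φ ∨' ψ ⟧ t = ⟦ φ ⟧ t ∨ᵛ ⟦ ψ ⟧ t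
  ⟦ φ ⇒ ψ ⟧ t = ⟦ φ ⟧ t ⇒ᵛ ⟦ ψ ⟧ t
  ⟦ ○ φ ⟧   t = ⟦ φ ⟧ (suc t)
  ⟦ ◇ φ ⟧   t = ◇ᵛ ⟦ φ ⟧ t
  ⟦ □ φ ⟧   t = □ᵛ ⟦ φ ⟧ t

  ⟦inst⟧ : ∀ σ A t → ⟦ inst σ A ⟧ t ≡ ⟦ A ⟧ₚ (λ n → ⟦ σ n ⟧ t)
  ⟦inst⟧ σ ⊥ₚ       t = refl
  ⟦inst⟧ σ (varₚ n) t = refl
  ⟦inst⟧ σ (A ∧ₚ B) t = cong₂ _∧ᵛ_ (⟦inst⟧ σ A t) (⟦inst⟧ σ B t)
  ⟦inst⟧ σ (A ∨ₚ B) t = cong₂ _∨ᵛ_ (⟦inst⟧ σ A t) (⟦inst⟧ σ B t)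
  ⟦inst⟧ σ (A ⇒ₚ B) t = cong₂ _⇒ᵛ_ (⟦inst⟧ σ A t) (⟦inst⟧ σ B t)

  -- An implication is valid at t when its antecedent is included in its
  -- consequent at t; the formulas are named since inclusion alone does not
  -- determine the opens involved.
  entails : ∀ φ ψ {t} → ⟦ φ ⟧ t ⊆ ⟦ ψ ⟧ t → Valid (⟦ φ ⇒ ψ ⟧ t)
  entails φ ψ {t} = ⊆⇒valid (⟦ φ ⟧ t) (⟦ ψ ⟧ t)

  -- ○ is a time shift and so commutes with the Heyting operations, which
  -- makes ax1–ax4 and ax10 hold by reflexivity; □ and ◇ are handled by
  -- their universal properties and the induction rules by iteration.
  sound : ∀ {φ} → ITLFS φ → ∀ t → Valid (⟦ φ ⟧ t)
  sound (taut σ A d) t = subst Valid (sym (⟦inst⟧ σ A t)) (ipc-sound d _)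
  sound ax1 t = entails (○ ⊥') ⊥' {t} ⊥-least
  sound (ax2 φ ψ) t = valid-∧ (entails (○ (φ ∧' ψ)) (○ φ ∧' ○ ψ) ⊆-refl)
                              (entails (○ φ ∧' ○ ψ) (○ (φ ∧' ψ)) ⊆-refl)
  sound (ax3 φ ψ) t = valid-∧ (entails (○ (φ ∨' ψ)) (○ φ ∨' ○ ψ) ⊆-refl)
                              (entails (○ φ ∨' ○ ψ) (○ (φ ∨' ψ)) ⊆-refl)
  sound (ax4 φ ψ) t = entails (○ (φ ⇒ ψ)) (○ φ ⇒ ○ ψ) ⊆-refl
  sound (ax5 φ ψ) t = entails (□ (φ ⇒ ψ)) (□ φ ⇒ □ ψ)
    (curry (⟦ □ φ ⟧ t) (⟦ □ ψ ⟧ t) (□-intro ⟦ ψ ⟧ λ k →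
      incl (λ m (h , g) → h k (g k)) (λ ((h , _) , (g , _)) → proj₁ (h k) (g k))))
  sound (ax6 φ ψ) t = entails (□ (φ ⇒ ψ)) (◇ φ ⇒ ◇ ψ)
    (curry (⟦ ◇ φ ⟧ t) (⟦ ◇ ψ ⟧ t)
      (incl (λ m (h , (k , x)) → k , h k x) (λ ((h , _) , (k , x)) → k , proj₁ (h k) x)))
  sound (ax7 φ ψ) t = entails (◇ (φ ∨' ψ)) (◇ φ ∨' ◇ ψ)
    (◇-elim ⟦ φ ∨' ψ ⟧ λ k → [ ◇-intro ⟦ φ ⟧ k ⨾ ι₁ , ◇-intro ⟦ ψ ⟧ k ⨾ ι₂ ]ᵛ)
  sound (ax8 φ) t = entails (□ φ) (φ ∧' ○ (□ φ))
    ⟨ □-elim ⟦ φ ⟧ 0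
    , □-intro ⟦ φ ⟧ (λ k → □-elim ⟦ φ ⟧ (suc k) ⨾ ⊆-reflexive (sym (later ⟦ φ ⟧ k t))) ⟩
  sound (ax9 φ) t = entails (φ ∨' ○ (◇ φ)) (◇ φ)
    [ ◇-intro ⟦ φ ⟧ 0
    , ◇-elim ⟦ φ ⟧ (λ k → ⊆-reflexive (later ⟦ φ ⟧ k t) ⨾ ◇-intro ⟦ φ ⟧ (suc k)) ]ᵛ
  sound (ax10 φ ψ) t = entails (○ φ ⇒ ○ ψ) (○ (φ ⇒ ψ)) ⊆-refl
  sound (ax11 φ ψ) t = entails (◇ φ ⇒ □ ψ) (□ (φ ⇒ ψ)) (□-intro ⟦ φ ⇒ ψ ⟧ λ k →
    curry (⟦ φ ⟧ (k + t)) (⟦ ψ ⟧ (k + t))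
      (incl (λ m (h , x) → h (k , x) k) (λ ((h , _) , x) → proj₁ (h (k , x)) k)))
  sound (ind□ {φ} d) t = entails φ (□ φ)
    (□-intro ⟦ φ ⟧ λ k → increasing ⟦ φ ⟧ (λ s → valid⇒⊆ (sound d s)) k t)
  sound (ind◇ {φ} d) t = entails (◇ φ) φ
    (◇-elim ⟦ φ ⟧ λ k → decreasing ⟦ φ ⟧ (λ s → valid⇒⊆ (sound d s)) k t)
  sound (mp d e) t = valid-mp (sound d t) (sound e t)
  sound (nec○ d) t = sound d (suc t)

P : ℕ → Open
P t = record
  { fin  = λ m → t < m
  ; inf  = ⊤
  ; nbhd = λ _ → from suc t onwards λ m t<m → t<m }

Q : ℕ → Open
Q t = record { fin = λ _ → ⊤ ; inf = ⊥ ; nbhd = λ () }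

-- □p fails at ∞: no point m satisfies p at all times, least of all a whole
-- neighbourhood of ∞ (the point N would need N + t < N).
□P-fails-at-∞ : ∀ t → ¬ inf (□ᵛ P t)
□P-fails-at-∞ t (_ , from N onwards holds) = m+n≮m N t (holds N ≤-refl N)

-- p ∨ q and ○q → q hold everywhere at all times: q covers the naturals,
-- p covers ∞, and Q is constant in time.
P∨Q-valid : ∀ t → Valid (P t ∨ᵛ Q t)
P∨Q-valid t = valid (λ m → inj₂ tt) (inj₁ tt)

Q-decreasing-valid : ∀ t → Valid (Q (suc t) ⇒ᵛ Q t)
Q-decreasing-valid t = ⊆⇒valid (Q (suc t)) (Q t) ⊆-refl

-- Both formulas fail at ∞ at time 0: their antecedents hold there, while
-- □p, ◇q and q do not.  They are stated for any families equal to P and Q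
-- so that they apply to a valuation which only reduces to P and Q up to ≡.
refute-□∨◇ : ∀ {A B} → A ≡ P → B ≡ Q →
             ¬ Valid (□ᵛ (λ s → A s ∨ᵛ B s) 0 ⇒ᵛ (□ᵛ A 0 ∨ᵛ ◇ᵛ B 0))
refute-□∨◇ refl refl (valid _ (implies-at-∞ , _)) =
  [ □P-fails-at-∞ 0 , (λ { (_ , ()) }) ]
    (implies-at-∞ (at-∞ (valid-□ (λ s → P s ∨ᵛ Q s) 0 P∨Q-valid)))

refute-□∨ : ∀ {A B} → A ≡ P → B ≡ Q →
            ¬ Valid ((□ᵛ (λ s → A s ∨ᵛ B s) 0 ∧ᵛ □ᵛ (λ s → B (suc s) ⇒ᵛ B s) 0)
                     ⇒ᵛ (□ᵛ A 0 ∨ᵛ B 0))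
refute-□∨ refl refl (valid _ (implies-at-∞ , _)) =
  [ □P-fails-at-∞ 0 , (λ ()) ]
    (implies-at-∞ ( at-∞ (valid-□ (λ s → P s ∨ᵛ Q s) 0 P∨Q-valid)
                  , at-∞ (valid-□ (λ s → Q (suc s) ⇒ᵛ Q s) 0 Q-decreasing-valid)))

valuation : ℕ → ℕ → ℕ → Open
valuation p n with n ≟ p
... | yes _ = P
... | no  _ = Q

valuation-at-p : ∀ p → valuation p p ≡ P
valuation-at-p p with p ≟ p
... | yes _   = refl
... | no  p≢p = ⊥-elim (p≢p refl)

valuation-at-q : ∀ {p q} → p ≢ q → valuation p q ≡ Q
valuation-at-q {p} {q} p≢q with q ≟ p
... | yes q≡p = ⊥-elim (p≢q (sym q≡p))
... | no  _   = refl

corollary6p2 : (p q : ℕ) → p ≢ q →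
    (¬ ITLFS (□ (var p ∨' var q) ⇒ (□ (var p) ∨' ◇ (var q))))
    × (¬ ITLFS ((□ (var p ∨' var q) ∧' □ (○ (var q) ⇒ var q)) ⇒ (□ (var p) ∨' var q)))
corollary6p2 p q p≢q =
    (λ d → refute-□∨◇ (valuation-at-p p) (valuation-at-q p≢q) (sound d 0))
  , (λ d → refute-□∨ (valuation-at-p p) (valuation-at-q p≢q) (sound d 0))
  where open Semantics (valuation p)
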